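{- Let $k\ge 2$ and $n\ge 1$ be integers and let $N$ satisfy $\frac{k^n-1}{k-1}\le N\le \frac{k^{n+1}-k}{k-1}$. Write $N-\frac{k^n-1}{k-1}=\sum_{i=0}^{n-1}a_i k^i$ with digits $a_i\in\{0,1,\dots,k-1\}$ (the base-$k$ expansion $a_{n-1}\dots a_1a_0$ with possible leading zeros). Then, starting with $N$ chips at the root of $T_k$, for each $0\le i\le n-1$ the stable configuration has exactly $a_i+1$ chips on each vertex of layer $i+1$.
   Context: Fix an integer $k\ge 2$. Let $T_k$ be the infinite rooted $k$-ary tree (every vertex has exactly $k$ children) with one additional self-loop at the root, so every vertex has degree $k+1$. A vertex is on layer $i+1$ if its distance from the root is $i$ (the root is on layer 1). Chip-firing: a vertex with at least $k+1$ chips may fire, sending one chip along each incident edge (a non-root vertex sends one chip to its parent and one to each of its $k$ children; the root sends one chip to each of its $k$ children and one chip to itself along the self-loop). Starting with $N$ chips at the root and none elsewhere, vertices fire until no vertex can fire; this always terminates, and the resulting stable configuration (every vertex has at most $k$ chips) is independent of the order of firings. -}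

module Defs where

open import Data.Nat using (ℕ; zero; suc; _+_; _*_; _∸_; _^_; _≤_)
open import Data.Fin using (Fin; toℕ)
open import Data.List using (List; []; _∷_; map; allFin)
open import Data.Nat.ListAction using (sum)
open import Data.List.Properties using (≡-dec)
open import Data.Fin.Properties using () renaming (_≟_ to _≟F_)
open import Data.Product using (Σ; _×_)
open import Relation.Binary.PropositionalEquality using (_≡_)
open import Relation.Nullary using (Dec; yes; no)

-- Vertices of T_k: a vertex is the path from the root, written as a list of
-- child indices in Fin k, with the MOST RECENT step at the head.
-- So [] is the root, the children of v are (j ∷ v) for j : Fin k,
-- and the parent of (j ∷ v) is v.  The vertex v lies on layer (length v + 1).
Vertex : ℕ → Set
Vertex k = List (Fin k)

_≟V_ : ∀ {k} → (v w : Vertex k) → Dec (v ≡ w)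
_≟V_ = ≡-dec _≟F_

ind : ∀ {p} {P : Set p} → Dec P → ℕ
ind (yes _) = 1
ind (no _)  = 0

-- Number of edges of T_k joining v and w (the self-loop at the root counts once).
edges : ∀ {k} → Vertex k → Vertex k → ℕ
edges [] [] = 1
edges [] (j ∷ w) = ind (w ≟V [])
edges (i ∷ v) [] = ind (v ≟V [])
edges (i ∷ v) (j ∷ w) = ind (w ≟V (i ∷ v)) + ind (v ≟V (j ∷ w))

Config : ℕ → Set
Config k = Vertex k → ℕ

-- Firing vertex v: v sends one chip along each of its k+1 incident edges
-- (for the root, one of them is the self-loop back to itself).
fire : ∀ k → Vertex k → Config k → Config k
fire k v c w with v ≟V w
... | yes _ = (c w ∸ suc k) + edges v w
... | no _  = c w + edges v w

data Reach (k : ℕ) : Config k → Config k → Set where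
  done : ∀ {c} → Reach k c c
  step : ∀ {c c'} (v : Vertex k) → suc k ≤ c v → Reach k (fire k v c) c' → Reach k c c'

Stable : ∀ k → Config k → Set
Stable k c = ∀ v → c v ≤ k

initial : ∀ k → ℕ → Config k
initial k N [] = N
initial k N (_ ∷ _) = 0

digitValue : ∀ k n → (Fin n → ℕ) → ℕ
digitValue k n a = sum (map (λ i → a i * k ^ toℕ i) (allFin n))

{-# OPTIONS --safe #-}
module Submission where

-- Firing is locally confluent: two loaded vertices can fire in either order with the same
-- result.  Hence a loaded vertex may always be fired first on the way to a stable
-- configuration, all stable configurations reachable from a given one agree, and it
-- suffices to exhibit a single firing sequence.
--
-- Add the N chips to the root one at a time.  Suppose every vertex at distance i from the
-- root holds d_i + 1 chips with 0 ≤ d_i < k.  An extra root chip raises d_0, unless the root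
-- reaches k + 1 chips and fires.  Whenever a whole layer reaches k + 1 chips it fires; the k
-- chips each vertex receives back from its children make the layer above fire again, and so
-- on up to the root, until all these layers hold one chip each and the next layer has gained
-- one chip.  This is the increment of the bijective base-k numeral N = Σ (d_i + 1) k^i, so
-- N chips produce the digits of N, and the hypothesis identifies them with the a_i.

open import Defs
open import Data.Fin using (Fin; toℕ) renaming (zero to fzero; suc to fsuc)
open import Data.Fin.Properties using () renaming (_≟_ to _≟F_)
open import Data.List using (List; []; _∷_; _++_; map; concatMap; allFin; length; replicate; tabulate)
open import Data.List.Properties using (map-++; map-∘; map-tabulate; length-tabulate)
open import Data.List.Relation.Unary.All using (All; []; _∷_)
open import Data.List.Relation.Unary.All.Properties using (tabulate⁺)
open import Data.Nat using (ℕ; zero; suc; _+_; _*_; _∸_; _^_; _≤_; _<_; s≤s; z≤n; _%_; NonZero; _≟_)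
open import Data.Nat.DivMod using ([m+kn]%n≡m%n; m<n⇒m%n≡m)
open import Data.Nat.ListAction using (sum)
open import Data.Nat.ListAction.Properties using (sum-++)
open import Data.Nat.Properties
open import Algebra.Properties.CommutativeSemigroup +-commutativeSemigroup using (interchange; xy∙z≈xz∙y)
open import Data.Nat.Tactic.RingSolver using (solve-∀)
open import Data.Product using (Σ; _×_; _,_)
open import Function using (_∘_)
open import Relation.Binary.PropositionalEquality
open import Relation.Binary.Structures using (IsPreorder)
open import Relation.Nullary using (Dec; yes; no; ¬_; contradiction)
open import Relation.Nullary.Decidable using (map′)
import Relation.Binary.Reasoning.Base.Double as PreorderReasoning

ind-yes : ∀ {p} {P : Set p} (d : Dec P) → P → ind d ≡ 1
ind-yes (yes _) _ = refl
ind-yes (no ¬p) p = contradiction p ¬p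

ind-no : ∀ {p} {P : Set p} (d : Dec P) → ¬ P → ind d ≡ 0
ind-no (yes p) ¬p = contradiction p ¬p
ind-no (no _) _ = refl

ind-map′ : ∀ {p q} {P : Set p} {Q : Set q} (f : P → Q) (g : Q → P) (d : Dec P) → ind (map′ f g d) ≡ ind d
ind-map′ f g (yes _) = refl
ind-map′ f g (no _) = refl

ind-sym : ∀ {k} (v w : Vertex k) → ind (v ≟V w) ≡ ind (w ≟V v)
ind-sym v w with v ≟V w
... | yes refl = sym (ind-yes (v ≟V v) refl)
... | no v≢w = sym (ind-no (w ≟V v) (v≢w ∘ sym))

δ : ℕ → ℕ → ℕ
δ zero zero = 1
δ zero (suc _) = 0
δ (suc _) zero = 0
δ (suc m) (suc n) = δ m n

δ≤1 : ∀ m n → δ m n ≤ 1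
δ≤1 zero zero = s≤s z≤n
δ≤1 zero (suc _) = z≤n
δ≤1 (suc _) zero = z≤n
δ≤1 (suc m) (suc n) = δ≤1 m n

δ≡1⇒≡ : ∀ m n → δ m n ≡ 1 → m ≡ n
δ≡1⇒≡ zero zero _ = refl
δ≡1⇒≡ (suc m) (suc n) δ≡1 = cong suc (δ≡1⇒≡ m n δ≡1)

∑ : ∀ {a} {A : Set a} → List A → (A → ℕ) → ℕ
∑ xs f = sum (map f xs)

module _ {a} {A : Set a} where

  ∑-cong : ∀ (xs : List A) {f g : A → ℕ} → (∀ x → f x ≡ g x) → ∑ xs f ≡ ∑ xs g
  ∑-cong [] _ = refl
  ∑-cong (x ∷ xs) f≗g = cong₂ _+_ (f≗g x) (∑-cong xs f≗g)

  ∑-zero : ∀ (xs : List A) {f : A → ℕ} → (∀ x → f x ≡ 0) → ∑ xs f ≡ 0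
  ∑-zero [] _ = refl
  ∑-zero (x ∷ xs) f≗0 = cong₂ _+_ (f≗0 x) (∑-zero xs f≗0)

  ∑-const : ∀ (xs : List A) c → ∑ xs (λ _ → c) ≡ length xs * c
  ∑-const [] c = refl
  ∑-const (x ∷ xs) c = cong (c +_) (∑-const xs c)

  ∑-+ : ∀ (xs : List A) f g → ∑ xs (λ x → f x + g x) ≡ ∑ xs f + ∑ xs g
  ∑-+ [] f g = refl
  ∑-+ (x ∷ xs) f g = trans (cong (f x + g x +_) (∑-+ xs f g)) (interchange (f x) (g x) (∑ xs f) (∑ xs g))

  ∑-*ˡ : ∀ (xs : List A) m f → ∑ xs (λ x → m * f x) ≡ m * ∑ xs f
  ∑-*ˡ [] m f = sym (*-zeroʳ m)
  ∑-*ˡ (x ∷ xs) m f = trans (cong (m * f x +_) (∑-*ˡ xs m f)) (sym (*-distribˡ-+ m (f x) _))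

  ∑-++ : ∀ (xs ys : List A) f → ∑ (xs ++ ys) f ≡ ∑ xs f + ∑ ys f
  ∑-++ xs ys f = trans (cong sum (map-++ f xs ys)) (sum-++ (map f xs) (map f ys))

  ∑-map : ∀ {b} {B : Set b} (g : B → A) (ys : List B) f → ∑ (map g ys) f ≡ ∑ ys (f ∘ g)
  ∑-map g ys f = cong sum (sym (map-∘ ys))

  ∑-concatMap : ∀ {b} {B : Set b} (g : B → List A) (ys : List B) f →
                ∑ (concatMap g ys) f ≡ ∑ ys (λ y → ∑ (g y) f)
  ∑-concatMap g [] f = refl
  ∑-concatMap g (y ∷ ys) f = trans (∑-++ (g y) (concatMap g ys) f) (cong (∑ (g y) f +_) (∑-concatMap g ys f))

∑-allFin-suc : ∀ m (f : Fin (suc m) → ℕ) → ∑ (allFin (suc m)) f ≡ f fzero + ∑ (allFin m) (f ∘ fsuc)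
∑-allFin-suc m f =
  cong (λ xs → f fzero + sum xs) (trans (map-tabulate {n = m} fsuc f) (sym (map-tabulate {n = m} (λ i → i) (f ∘ fsuc))))

∑-allFin-const : ∀ m c → ∑ (allFin m) (λ _ → c) ≡ m * c
∑-allFin-const m c = trans (∑-const (allFin m) c) (cong (_* c) (length-tabulate {n = m} (λ i → i)))

∑-allFin-≟ : ∀ m (y : Fin m) → ∑ (allFin m) (λ i → ind (i ≟F y)) ≡ 1
∑-allFin-≟ (suc m) fzero =
  trans (∑-allFin-suc m (λ i → ind (i ≟F fzero))) (cong suc (∑-zero (allFin m) (λ _ → refl)))
∑-allFin-≟ (suc m) (fsuc y) = begin
  ∑ (allFin (suc m)) (λ i → ind (i ≟F fsuc y)) ≡⟨ ∑-allFin-suc m (λ i → ind (i ≟F fsuc y)) ⟩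
  ∑ (allFin m) (λ i → ind (fsuc i ≟F fsuc y))  ≡⟨ ∑-cong (allFin m) (λ i → ind-map′ _ _ (i ≟F y)) ⟩
  ∑ (allFin m) (λ i → ind (i ≟F y))            ≡⟨ ∑-allFin-≟ m y ⟩
  1                                             ∎
  where open ≡-Reasoning

-- Composes the chip balances of two successive firings, stated additively to avoid truncated subtraction.
balance-trans : ∀ {a b c i j e f} s → a + i * s ≡ b + e → b + j * s ≡ c + f → a + (j + i) * s ≡ c + (f + e)
balance-trans {a} {b} {c} {i} {j} {e} {f} s a≡b b≡c = begin
  a + (j + i) * s      ≡⟨ shuffle a i j s ⟩
  (a + i * s) + j * s  ≡⟨ cong (_+ j * s) a≡b ⟩
  (b + e) + j * s      ≡⟨ xy∙z≈xz∙y b e (j * s) ⟩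
  (b + j * s) + e      ≡⟨ cong (_+ e) b≡c ⟩
  (c + f) + e          ≡⟨ +-assoc c f e ⟩
  c + (f + e)          ∎
  where
  open ≡-Reasoning
  shuffle : ∀ a i j s → a + (j + i) * s ≡ (a + i * s) + j * s
  shuffle = solve-∀

replicate-suc-++ : ∀ {a} {A : Set a} n (x : A) ys → replicate (suc n) x ++ ys ≡ replicate n x ++ x ∷ ys
replicate-suc-++ zero x ys = refl
replicate-suc-++ (suc n) x ys = cong (x ∷_) (replicate-suc-++ n x ys)

infixl 9 _!_
_!_ : List ℕ → ℕ → ℕ
[] ! _ = 0
(p ∷ _) ! zero = p
(_ ∷ ps) ! suc m = ps ! m

!-++ : ∀ xs ys m → (xs ++ ys) ! (length xs + m) ≡ ys ! m
!-++ [] ys m = refl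
!-++ (x ∷ xs) ys m = !-++ xs ys m

!-tabulate : ∀ {n} (f : Fin n → ℕ) i → tabulate f ! toℕ i ≡ f i
!-tabulate f fzero = refl
!-tabulate f (fsuc i) = !-tabulate (f ∘ fsuc) i

sucHead : List ℕ → List ℕ
sucHead [] = 1 ∷ []
sucHead (p ∷ ps) = suc p ∷ ps

division-unique : ∀ k .{{_ : NonZero k}} {d e q r} → d < k → e < k → d + k * q ≡ e + k * r → d ≡ e × q ≡ r
division-unique k {d} {e} {q} {r} d<k e<k eq =
  d≡e , *-cancelˡ-≡ q r k (+-cancelˡ-≡ d _ _ (trans eq (cong (_+ k * r) (sym d≡e))))
  where
  remainder : ∀ {x} y → x < k → (x + k * y) % k ≡ x
  remainder {x} y x<k = trans (cong (λ n → (x + n) % k) (*-comm k y)) (trans ([m+kn]%n≡m%n x y k) (m<n⇒m%n≡m x<k))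
  d≡e : d ≡ e
  d≡e = trans (sym (remainder q d<k)) (trans (cong (_% k) eq) (remainder r e<k))

module Digits (k : ℕ) where

  inc : List ℕ → List ℕ
  inc [] = 0 ∷ []
  inc (d ∷ ds) with suc d ≟ k
  ... | yes _ = 0 ∷ inc ds
  ... | no _ = suc d ∷ ds

  digits : ℕ → List ℕ
  digits zero = []
  digits (suc n) = inc (digits n)

  value : List ℕ → ℕ
  value [] = 0
  value (d ∷ ds) = suc d + k * value ds

  value-inc : ∀ ds → value (inc ds) ≡ suc (value ds)
  value-inc [] = cong suc (*-zeroʳ k)
  value-inc (d ∷ ds) with suc d ≟ k
  ... | no _ = refl
  ... | yes d+1≡k = begin
    1 + k * value (inc ds)     ≡⟨ cong (λ n → 1 + k * n) (value-inc ds) ⟩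
    1 + k * suc (value ds)     ≡⟨ cong suc (*-suc k (value ds)) ⟩
    suc (k + k * value ds)     ≡⟨ cong (λ n → suc (n + k * value ds)) d+1≡k ⟨
    suc (suc d + k * value ds) ∎
    where open ≡-Reasoning

  value-digits : ∀ N → value (digits N) ≡ N
  value-digits zero = refl
  value-digits (suc N) = trans (value-inc (digits N)) (cong suc (value-digits N))

  inc-< : 0 < k → ∀ {ds} → All (_< k) ds → All (_< k) (inc ds)
  inc-< 0<k [] = 0<k ∷ []
  inc-< 0<k {d ∷ ds} (d<k ∷ ds<k) with suc d ≟ k
  ... | yes _ = 0<k ∷ inc-< 0<k ds<k
  ... | no d+1≢k = ≤∧≢⇒< d<k d+1≢k ∷ ds<k

  digits-< : 0 < k → ∀ N → All (_< k) (digits N)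
  digits-< 0<k zero = []
  digits-< 0<k (suc N) = inc-< 0<k (digits-< 0<k N)

  value-injective : .{{_ : NonZero k}} → ∀ {ds es} → All (_< k) ds → All (_< k) es → value ds ≡ value es → ds ≡ es
  value-injective [] [] _ = refl
  value-injective (d<k ∷ ds<k) (e<k ∷ es<k) eq with division-unique k d<k e<k (suc-injective eq)
  ... | refl , same-rest = cong (_ ∷_) (value-injective ds<k es<k same-rest)

  digitValue-suc : ∀ n (a : Fin (suc n) → ℕ) → digitValue k (suc n) a ≡ a fzero + k * digitValue k n (a ∘ fsuc)
  digitValue-suc n a = begin
    digitValue k (suc n) a
      ≡⟨ ∑-allFin-suc n (λ i → a i * k ^ toℕ i) ⟩
    a fzero * 1 + ∑ (allFin n) (λ i → a (fsuc i) * (k * k ^ toℕ i))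
      ≡⟨ cong₂ _+_ (*-identityʳ (a fzero)) (∑-cong (allFin n) (λ i → x*[y*z]≡y*[x*z] (a (fsuc i)) k _)) ⟩
    a fzero + ∑ (allFin n) (λ i → k * (a (fsuc i) * k ^ toℕ i))
      ≡⟨ cong (a fzero +_) (∑-*ˡ (allFin n) k _) ⟩
    a fzero + k * digitValue k n (a ∘ fsuc)
      ∎
    where
    open ≡-Reasoning
    x*[y*z]≡y*[x*z] : ∀ x y z → x * (y * z) ≡ y * (x * z)
    x*[y*z]≡y*[x*z] = solve-∀

  value-tabulate : ∀ n (a : Fin n → ℕ) → value (tabulate a) ≡ digitValue k n a + value (replicate n 0)
  value-tabulate zero a = refl
  value-tabulate (suc n) a = begin
    suc (a fzero) + k * value (tabulate (a ∘ fsuc))         ≡⟨ cong (λ x → suc (a fzero) + k * x) (value-tabulate n (a ∘ fsuc)) ⟩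
    suc (a fzero) + k * (digitValue k n (a ∘ fsuc) + R)     ≡⟨ regroup (a fzero) k (digitValue k n (a ∘ fsuc)) R ⟩
    (a fzero + k * digitValue k n (a ∘ fsuc)) + (1 + k * R) ≡⟨ cong (_+ (1 + k * R)) (digitValue-suc n a) ⟨
    digitValue k (suc n) a + value (replicate (suc n) 0)    ∎
    where
    open ≡-Reasoning
    R = value (replicate n 0)
    regroup : ∀ a k D R → suc a + k * (D + R) ≡ (a + k * D) + (1 + k * R)
    regroup = solve-∀

value-replicate-0 : ∀ K n → K * Digits.value (suc K) (replicate n 0) + 1 ≡ suc K ^ n
value-replicate-0 K zero = cong (_+ 1) (*-zeroʳ K)
value-replicate-0 K (suc n) = begin
  K * (1 + suc K * R) + 1 ≡⟨ distribute K R ⟩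
  suc K * (K * R + 1)     ≡⟨ cong (suc K *_) (value-replicate-0 K n) ⟩
  suc K * suc K ^ n       ∎
  where
  open ≡-Reasoning
  R = Digits.value (suc K) (replicate n 0)
  distribute : ∀ K R → K * (1 + suc K * R) + 1 ≡ suc K * (K * R + 1)
  distribute = solve-∀

value-tabulate-scaled : ∀ K n (a : Fin n → ℕ) →
  K * Digits.value (suc K) (tabulate a) ≡ (suc K ^ n ∸ 1) + K * digitValue (suc K) n a
value-tabulate-scaled K n a = begin
  K * value (tabulate a)  ≡⟨ cong (K *_) (value-tabulate n a) ⟩
  K * (D + R)             ≡⟨ *-distribˡ-+ K D R ⟩
  K * D + K * R           ≡⟨ +-comm (K * D) (K * R) ⟩
  K * R + K * D           ≡⟨ cong (_+ K * D) (m+n∸n≡m (K * R) 1) ⟨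
  (K * R + 1 ∸ 1) + K * D ≡⟨ cong (λ x → x ∸ 1 + K * D) (value-replicate-0 K n) ⟩
  (suc K ^ n ∸ 1) + K * D ∎
  where
  open ≡-Reasoning
  open Digits (suc K)
  D = digitValue (suc K) n a
  R = value (replicate n 0)

module Firing (k : ℕ) where

  Loaded : Config k → Vertex k → Set
  Loaded c v = suc k ≤ c v

  fire-balance : ∀ {v} c → Loaded c v → ∀ w → fire k v c w + ind (v ≟V w) * suc k ≡ c w + edges v w
  fire-balance {v} c loaded w with v ≟V w
  ... | yes refl = begin
    c v ∸ suc k + edges v v + (suc k + 0) ≡⟨ cong (c v ∸ suc k + edges v v +_) (+-identityʳ (suc k)) ⟩
    c v ∸ suc k + edges v v + suc k       ≡⟨ xy∙z≈xz∙y (c v ∸ suc k) (edges v v) (suc k) ⟩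
    c v ∸ suc k + suc k + edges v v       ≡⟨ cong (_+ edges v v) (m∸n+n≡m loaded) ⟩
    c v + edges v v                       ∎
    where open ≡-Reasoning
  ... | no _ = +-identityʳ (c w + edges v w)

  fire-≢-mono : ∀ {v w} c → v ≢ w → c w ≤ fire k v c w
  fire-≢-mono {v} {w} c v≢w with v ≟V w
  ... | yes v≡w = contradiction v≡w v≢w
  ... | no _ = m≤m+n (c w) (edges v w)

  fire-cong : ∀ v {c d} → c ≗ d → fire k v c ≗ fire k v d
  fire-cong v c≗d w with v ≟V w
  ... | yes _ = cong (λ x → x ∸ suc k + edges v w) (c≗d w)
  ... | no _ = cong (_+ edges v w) (c≗d w)

  fire-comm : ∀ {v w c} → v ≢ w → Loaded c v → Loaded c w → fire k v (fire k w c) ≗ fire k w (fire k v c)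
  fire-comm {v} {w} {c} v≢w v-loaded w-loaded x = +-cancelʳ-≡ _ _ _ (begin
    fire k v (fire k w c) x + (Iw + Iv) * suc k ≡⟨ twice v w (v≢w ∘ sym) w-loaded v-loaded ⟩
    c x + (edges w x + edges v x)               ≡⟨ cong (c x +_) (+-comm (edges w x) (edges v x)) ⟩
    c x + (edges v x + edges w x)               ≡⟨ twice w v v≢w v-loaded w-loaded ⟨
    fire k w (fire k v c) x + (Iv + Iw) * suc k ≡⟨ cong (λ n → fire k w (fire k v c) x + n * suc k) (+-comm Iv Iw) ⟩
    fire k w (fire k v c) x + (Iw + Iv) * suc k ∎)
    where
    open ≡-Reasoning
    Iv = ind (v ≟V x)
    Iw = ind (w ≟V x)
    twice : ∀ u u′ → u′ ≢ u → Loaded c u′ → Loaded c u →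
            fire k u (fire k u′ c) x + (ind (u′ ≟V x) + ind (u ≟V x)) * suc k ≡ c x + (edges u′ x + edges u x)
    twice u u′ u′≢u u′-loaded u-loaded =
      balance-trans {i = ind (u ≟V x)} {j = ind (u′ ≟V x)} {e = edges u x} {f = edges u′ x} (suc k)
                    (fire-balance (fire k u′ c) (≤-trans u-loaded (fire-≢-mono c u′≢u)) x) (fire-balance c u′-loaded x)

  -- Configurations are functions and there is no function extensionality, so firing
  -- sequences can only be compared up to _≗_.
  _⇝_ : Config k → Config k → Set
  c ⇝ d = Σ (Config k) λ d′ → Reach k c d′ × d′ ≗ d

  Reach⇒⇝ : ∀ {c d} → Reach k c d → c ⇝ d
  Reach⇒⇝ r = _ , r , λ _ → refl

  Reach-trans : ∀ {b c d} → Reach k b c → Reach k c d → Reach k b d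
  Reach-trans done r = r
  Reach-trans (step v loaded r) r′ = step v loaded (Reach-trans r r′)

  Reach-respˡ-≗ : ∀ {c c′ d} → c ≗ c′ → Reach k c d → c′ ⇝ d
  Reach-respˡ-≗ c≗c′ done = _ , done , λ x → sym (c≗c′ x)
  Reach-respˡ-≗ c≗c′ (step v loaded r) with Reach-respˡ-≗ (fire-cong v c≗c′) r
  ... | d′ , r′ , d′≗d = d′ , step v (subst (suc k ≤_) (c≗c′ v) loaded) r′ , d′≗d

  ≗⇒⇝ : ∀ {c d} → c ≗ d → c ⇝ d
  ≗⇒⇝ c≗d = _ , done , c≗d

  ⇝-trans : ∀ {b c d} → b ⇝ c → c ⇝ d → b ⇝ d
  ⇝-trans (c′ , r₁ , c′≗c) (d′ , r₂ , d′≗d) with Reach-respˡ-≗ (λ x → sym (c′≗c x)) r₂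
  ... | d″ , r₂′ , d″≗d′ = d″ , Reach-trans r₁ r₂′ , λ x → trans (d″≗d′ x) (d′≗d x)

  ⇝-step : ∀ {c d} v → Loaded c v → fire k v c ⇝ d → c ⇝ d
  ⇝-step v loaded (d′ , r , d′≗d) = d′ , step v loaded r , d′≗d

  ⇝-isPreorder : IsPreorder _≗_ _⇝_
  ⇝-isPreorder = record
    { isEquivalence = record { refl = λ _ → refl ; sym = λ e x → sym (e x) ; trans = λ e e′ x → trans (e x) (e′ x) }
    ; reflexive = ≗⇒⇝
    ; trans = ⇝-trans
    }

  module ⇝-Reasoning = PreorderReasoning ⇝-isPreorder

  Stable-resp-≗ : ∀ {c d} → c ≗ d → Stable k d → Stable k c
  Stable-resp-≗ c≗d stable v = subst (_≤ k) (sym (c≗d v)) (stable v)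

  stable⇒¬Loaded : ∀ {c} v → Stable k c → ¬ Loaded c v
  stable⇒¬Loaded v stable loaded = <⇒≱ loaded (stable v)

  fire-first : ∀ {c d} v → Reach k c d → Stable k d → Loaded c v → fire k v c ⇝ d
  fire-first v done stable loaded = contradiction loaded (stable⇒¬Loaded v stable)
  fire-first {c} {d} v (step w w-loaded r) stable v-loaded with w ≟V v
  ... | yes refl = Reach⇒⇝ r
  ... | no w≢v = ⇝-step w (≤-trans w-loaded (fire-≢-mono c (w≢v ∘ sym))) (begin
    fire k w (fire k v c) ≈⟨ fire-comm w≢v w-loaded v-loaded ⟩
    fire k v (fire k w c) ≲⟨ fire-first v r stable (≤-trans v-loaded (fire-≢-mono c w≢v)) ⟩
    d                     ∎)
    where open ⇝-Reasoning

  stable-unique : ∀ {c d₁ d₂} → Reach k c d₁ → Stable k d₁ → Reach k c d₂ → Stable k d₂ → d₁ ≗ d₂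
  stable-unique done _ done _ _ = refl
  stable-unique done stable₁ (step v loaded _) _ = contradiction loaded (stable⇒¬Loaded v stable₁)
  stable-unique (step v loaded r₁) stable₁ r₂ stable₂ x with fire-first v r₂ stable₂ loaded
  ... | d₂′ , r₂′ , d₂′≗d₂ =
    trans (stable-unique r₁ stable₁ r₂′ (Stable-resp-≗ d₂′≗d₂ stable₂) x) (d₂′≗d₂ x)

  addChips : Config k → Config k → Config k
  addChips e c v = e v + c v

  fire-addChips : ∀ e v c → Loaded c v → fire k v (addChips e c) ≗ addChips e (fire k v c)
  fire-addChips e v c loaded w with v ≟V w
  ... | yes refl = begin
    e v + c v ∸ suc k + edges v v   ≡⟨ cong (_+ edges v v) (+-∸-assoc (e v) loaded) ⟩
    e v + (c v ∸ suc k) + edges v v ≡⟨ +-assoc (e v) (c v ∸ suc k) (edges v v) ⟩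
    e v + (c v ∸ suc k + edges v v) ∎
    where open ≡-Reasoning
  ... | no _ = +-assoc (e w) (c w) (edges v w)

  Reach-addChips : ∀ e {c d} → Reach k c d → addChips e c ⇝ addChips e d
  Reach-addChips e {c} done = ≗⇒⇝ {addChips e c} (λ _ → refl)
  Reach-addChips e {c} {d} (step v loaded r) = ⇝-step v (≤-trans loaded (m≤n+m (c v) (e v))) (begin
    fire k v (addChips e c) ≈⟨ fire-addChips e v c loaded ⟩
    addChips e (fire k v c) ≲⟨ Reach-addChips e r ⟩
    addChips e d            ∎)
    where open ⇝-Reasoning

  ⇝-addChips : ∀ e {c d} → c ⇝ d → addChips e c ⇝ addChips e d
  ⇝-addChips e (_ , r , d′≗d) = ⇝-trans (Reach-addChips e r) (≗⇒⇝ λ v → cong (e v +_) (d′≗d v))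

  multiplicity : List (Vertex k) → Vertex k → ℕ
  multiplicity vs x = ∑ vs (λ v → ind (v ≟V x))

  fire-all : ∀ vs c → (∀ x → multiplicity vs x ≤ 1) → (∀ x → multiplicity vs x ≡ 1 → Loaded c x) →
             Σ (Config k) λ d → Reach k c d × (∀ x → d x + multiplicity vs x * suc k ≡ c x + ∑ vs (λ v → edges v x))
  fire-all [] c _ _ = c , done , λ _ → refl
  fire-all (v ∷ vs) c repetition-free loaded =
    let d , r , balance = fire-all vs (fire k v c) repetition-free′ loaded′
    in d , step v v-loaded r , λ x →
         balance-trans {i = multiplicity vs x} {j = ind (v ≟V x)} {e = ∑ vs (λ u → edges u x)} {f = edges v x} (suc k)
                       (balance x) (fire-balance c v-loaded x)
    where
    v∉vs : multiplicity vs v ≡ 0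
    v∉vs = n≤0⇒n≡0 (≤-pred (subst (λ n → n + multiplicity vs v ≤ 1) (ind-yes (v ≟V v) refl) (repetition-free v)))
    v-loaded : Loaded c v
    v-loaded = loaded v (cong₂ _+_ (ind-yes (v ≟V v) refl) v∉vs)
    repetition-free′ : ∀ x → multiplicity vs x ≤ 1
    repetition-free′ x = ≤-trans (m≤n+m (multiplicity vs x) _) (repetition-free x)
    loaded′ : ∀ x → multiplicity vs x ≡ 1 → Loaded (fire k v c) x
    loaded′ x once =
      ≤-trans (loaded x (trans (cong (_+ multiplicity vs x) (ind-no (v ≟V x) v≢x)) once)) (fire-≢-mono c v≢x)
      where
      v≢x : v ≢ x
      v≢x refl = 0≢1+n (trans (sym v∉vs) once)

module Layers (k : ℕ) where
  open Firing k

  -- layer j lists the vertices at distance j from the root, i.e. the paper's layer j + 1.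
  layer : ℕ → List (Vertex k)
  layer zero = [] ∷ []
  layer (suc j) = concatMap (λ w → map (_∷ w) (allFin k)) (layer j)

  ∑-layer-suc : ∀ j f → ∑ (layer (suc j)) f ≡ ∑ (layer j) (λ w → ∑ (allFin k) (λ i → f (i ∷ w)))
  ∑-layer-suc j f = trans (∑-concatMap _ (layer j) f) (∑-cong (layer j) (λ w → ∑-map (_∷ w) (allFin k) f))

  ind-∷ : ∀ i (w : Vertex k) y z → ind ((i ∷ w) ≟V (y ∷ z)) ≡ ind (w ≟V z) * ind (i ≟F y)
  ind-∷ i w y z with i ≟F y | w ≟V z
  ... | yes _ | yes _ = refl
  ... | yes _ | no _ = refl
  ... | no _ | yes _ = refl
  ... | no _ | no _ = refl

  ∑-children-≟ : ∀ (w : Vertex k) y z → ∑ (allFin k) (λ i → ind ((i ∷ w) ≟V (y ∷ z))) ≡ ind (w ≟V z)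
  ∑-children-≟ w y z = begin
    ∑ (allFin k) (λ i → ind ((i ∷ w) ≟V (y ∷ z)))    ≡⟨ ∑-cong (allFin k) (λ i → ind-∷ i w y z) ⟩
    ∑ (allFin k) (λ i → ind (w ≟V z) * ind (i ≟F y)) ≡⟨ ∑-*ˡ (allFin k) (ind (w ≟V z)) _ ⟩
    ind (w ≟V z) * ∑ (allFin k) (λ i → ind (i ≟F y)) ≡⟨ cong (ind (w ≟V z) *_) (∑-allFin-≟ k y) ⟩
    ind (w ≟V z) * 1                                  ≡⟨ *-identityʳ _ ⟩
    ind (w ≟V z)                                      ∎
    where open ≡-Reasoning

  multiplicity-layer : ∀ j x → multiplicity (layer j) x ≡ δ (length x) j
  multiplicity-layer zero [] = refl
  multiplicity-layer zero (_ ∷ _) = refl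
  multiplicity-layer (suc j) [] = trans (∑-layer-suc j _) (∑-zero (layer j) (λ w → ∑-zero (allFin k) (λ _ → refl)))
  multiplicity-layer (suc j) (y ∷ z) = begin
    multiplicity (layer (suc j)) (y ∷ z)                              ≡⟨ ∑-layer-suc j _ ⟩
    ∑ (layer j) (λ w → ∑ (allFin k) (λ i → ind ((i ∷ w) ≟V (y ∷ z)))) ≡⟨ ∑-cong (layer j) (λ w → ∑-children-≟ w y z) ⟩
    multiplicity (layer j) z                                          ≡⟨ multiplicity-layer j z ⟩
    δ (length z) j                                                    ∎
    where open ≡-Reasoning

  ∑-layer-const-≟ : ∀ j x → ∑ (layer j) (λ w → ∑ (allFin k) (λ _ → ind (w ≟V x))) ≡ k * δ (length x) j
  ∑-layer-const-≟ j x = begin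
    ∑ (layer j) (λ w → ∑ (allFin k) (λ _ → ind (w ≟V x))) ≡⟨ ∑-cong (layer j) (λ w → ∑-allFin-const k _) ⟩
    ∑ (layer j) (λ w → k * ind (w ≟V x))                  ≡⟨ ∑-*ˡ (layer j) k _ ⟩
    k * multiplicity (layer j) x                          ≡⟨ cong (k *_) (multiplicity-layer j x) ⟩
    k * δ (length x) j                                    ∎
    where open ≡-Reasoning

  edgesFromLayer : ℕ → ℕ → ℕ
  edgesFromLayer zero m = δ m 0 + δ m 1
  edgesFromLayer (suc j) m = δ m (suc (suc j)) + k * δ m j

  ∑-layer-edges : ∀ j x → ∑ (layer j) (λ w → edges w x) ≡ edgesFromLayer j (length x)
  ∑-layer-edges zero [] = refl
  ∑-layer-edges zero (_ ∷ []) = refl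
  ∑-layer-edges zero (_ ∷ _ ∷ _) = refl
  ∑-layer-edges (suc j) [] = trans (∑-layer-suc j _) (∑-layer-const-≟ j [])
  ∑-layer-edges (suc j) (y ∷ z) = begin
    ∑ (layer (suc j)) (λ w → edges w (y ∷ z))
      ≡⟨ ∑-layer-suc j _ ⟩
    ∑ (layer j) (λ w → ∑ (allFin k) (λ i → ind (z ≟V (i ∷ w)) + ind (w ≟V (y ∷ z))))
      ≡⟨ ∑-cong (layer j) (λ w → ∑-+ (allFin k) _ _) ⟩
    ∑ (layer j) (λ w → ∑ (allFin k) (λ i → ind (z ≟V (i ∷ w))) + ∑ (allFin k) (λ _ → ind (w ≟V (y ∷ z))))
      ≡⟨ ∑-+ (layer j) _ _ ⟩
    ∑ (layer j) (λ w → ∑ (allFin k) (λ i → ind (z ≟V (i ∷ w)))) + ∑ (layer j) (λ w → ∑ (allFin k) (λ _ → ind (w ≟V (y ∷ z))))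
      ≡⟨ cong₂ _+_ children (∑-layer-const-≟ j (y ∷ z)) ⟩
    δ (length z) (suc j) + k * δ (suc (length z)) j
      ∎
    where
    open ≡-Reasoning
    children : ∑ (layer j) (λ w → ∑ (allFin k) (λ i → ind (z ≟V (i ∷ w)))) ≡ δ (length z) (suc j)
    children = begin
      ∑ (layer j) (λ w → ∑ (allFin k) (λ i → ind (z ≟V (i ∷ w)))) ≡⟨ ∑-layer-suc j (λ u → ind (z ≟V u)) ⟨
      ∑ (layer (suc j)) (λ u → ind (z ≟V u))                       ≡⟨ ∑-cong (layer (suc j)) (ind-sym z) ⟩
      multiplicity (layer (suc j)) z                               ≡⟨ multiplicity-layer (suc j) z ⟩
      δ (length z) (suc j)                                         ∎

module LayeredFiring (k : ℕ) where
  open Firing k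
  open Layers k
  open Digits k

  layered : List ℕ → Config k
  layered ps v = ps ! length v

  layered-stable : ∀ {ds} → All (_< k) ds → Stable k (layered (map suc ds))
  layered-stable ds<k v = go ds<k (length v)
    where
    go : ∀ {ds} → All (_< k) ds → ∀ m → map suc ds ! m ≤ k
    go [] m = z≤n
    go (d<k ∷ _) zero = d<k
    go (_ ∷ ds<k) (suc m) = go ds<k m

  LayerFiring : ℕ → List ℕ → List ℕ → Set
  LayerFiring j ps qs = ∀ m → qs ! m + δ m j * suc k ≡ ps ! m + edgesFromLayer j m

  fire-layer : ∀ j ps qs → LayerFiring j ps qs → suc k ≤ ps ! j → layered ps ⇝ layered qs
  fire-layer j ps qs firing loaded =
    let d , r , balance = fire-all (layer j) (layered ps) repetition-free layer-loaded
    in d , r , λ x → +-cancelʳ-≡ _ _ _ (begin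
      d x + δ (length x) j * suc k                  ≡⟨ cong (λ n → d x + n * suc k) (multiplicity-layer j x) ⟨
      d x + multiplicity (layer j) x * suc k        ≡⟨ balance x ⟩
      ps ! length x + ∑ (layer j) (λ w → edges w x) ≡⟨ cong (ps ! length x +_) (∑-layer-edges j x) ⟩
      ps ! length x + edgesFromLayer j (length x)   ≡⟨ firing (length x) ⟨
      qs ! length x + δ (length x) j * suc k        ∎)
    where
    open ≡-Reasoning
    repetition-free : ∀ x → multiplicity (layer j) x ≤ 1
    repetition-free x = subst (_≤ 1) (sym (multiplicity-layer j x)) (δ≤1 (length x) j)
    layer-loaded : ∀ x → multiplicity (layer j) x ≡ 1 → Loaded (layered ps) x
    layer-loaded x once = subst (λ m → suc k ≤ ps ! m) (sym (δ≡1⇒≡ _ _ (trans (sym (multiplicity-layer j x)) once))) loaded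

  LayerFiring-∷ : ∀ {j ps qs} x → LayerFiring (suc j) ps qs → LayerFiring (suc (suc j)) (x ∷ ps) (x ∷ qs)
  LayerFiring-∷ x firing zero = cong (x +_) (sym (*-zeroʳ k))
  LayerFiring-∷ x firing (suc m) = firing m

  LayerFiring-++ : ∀ xs {ps qs} → LayerFiring 1 ps qs → LayerFiring (suc (length xs)) (xs ++ ps) (xs ++ qs)
  LayerFiring-++ [] firing = firing
  LayerFiring-++ (x ∷ xs) firing = LayerFiring-∷ x (LayerFiring-++ xs firing)

  LayerFiring-root : ∀ a ps → LayerFiring 0 ((a + suc k) ∷ ps) (suc a ∷ sucHead ps)
  LayerFiring-root a ps zero = root a k
    where
    root : ∀ a k → suc a + 1 * suc k ≡ a + suc k + 1
    root = solve-∀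
  LayerFiring-root a [] (suc zero) = refl
  LayerFiring-root a (b ∷ ps) (suc zero) = trans (+-identityʳ (suc b)) (+-comm 1 b)
  LayerFiring-root a [] (suc (suc m)) = refl
  LayerFiring-root a (b ∷ ps) (suc (suc m)) = refl

  LayerFiring-1 : ∀ a b ps → LayerFiring 1 (a ∷ (b + suc k) ∷ ps) ((a + k) ∷ b ∷ sucHead ps)
  LayerFiring-1 a b ps zero = parent a k
    where
    parent : ∀ a k → a + k + 0 * suc k ≡ a + (0 + k * 1)
    parent = solve-∀
  LayerFiring-1 a b ps (suc zero) = self b k
    where
    self : ∀ b k → b + 1 * suc k ≡ b + suc k + (0 + k * 0)
    self = solve-∀
  LayerFiring-1 a b [] (suc (suc zero)) = cong suc (sym (*-zeroʳ k))
  LayerFiring-1 a b (c ∷ ps) (suc (suc zero)) = child c k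
    where
    child : ∀ c k → suc c + 0 * suc k ≡ c + (1 + k * 0)
    child = solve-∀
  LayerFiring-1 a b [] (suc (suc (suc m))) = sym (*-zeroʳ k)
  LayerFiring-1 a b (c ∷ ps) (suc (suc (suc m))) = cong (ps ! m +_) (sym (*-zeroʳ k))

  fire-root : ∀ a ps → layered ((a + suc k) ∷ ps) ⇝ layered (suc a ∷ sucHead ps)
  fire-root a ps = fire-layer 0 ((a + suc k) ∷ ps) (suc a ∷ sucHead ps) (LayerFiring-root a ps) (m≤n+m (suc k) a)

  fire-inner-layer : ∀ xs a b ps → layered (xs ++ a ∷ (b + suc k) ∷ ps) ⇝ layered (xs ++ (a + k) ∷ b ∷ sucHead ps)
  fire-inner-layer xs a b ps =
    fire-layer (suc (length xs)) (xs ++ a ∷ (b + suc k) ∷ ps) (xs ++ (a + k) ∷ b ∷ sucHead ps)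
               (LayerFiring-++ xs (LayerFiring-1 a b ps)) (subst (suc k ≤_) (sym loaded) (m≤n+m (suc k) b))
    where
    loaded : (xs ++ a ∷ (b + suc k) ∷ ps) ! suc (length xs) ≡ b + suc k
    loaded = trans (cong ((xs ++ a ∷ (b + suc k) ∷ ps) !_) (+-comm 1 (length xs))) (!-++ xs _ 1)

  -- The full layer fires; the k chips each parent gets back make the layer above full, and
  -- so on up to the root, whose firing refills the layer below it.
  carry : ∀ t ps → layered (replicate t 1 ++ suc k ∷ ps) ⇝ layered (replicate (suc t) 1 ++ sucHead ps)
  carry zero ps = fire-root 0 ps
  carry (suc t) ps = begin
    layered (replicate (suc t) 1 ++ suc k ∷ ps)       ≡⟨ cong layered (replicate-suc-++ t 1 _) ⟩
    layered (replicate t 1 ++ 1 ∷ suc k ∷ ps)         ≲⟨ fire-inner-layer (replicate t 1) 1 0 ps ⟩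
    layered (replicate t 1 ++ suc k ∷ 0 ∷ sucHead ps) ≲⟨ carry t (0 ∷ sucHead ps) ⟩
    layered (replicate (suc t) 1 ++ 1 ∷ sucHead ps)   ≡⟨ cong layered (replicate-suc-++ (suc t) 1 _) ⟨
    layered (replicate (suc (suc t)) 1 ++ sucHead ps) ∎
    where open ⇝-Reasoning

  increment : ∀ t ds → layered (replicate t 1 ++ sucHead (map suc ds)) ⇝ layered (replicate t 1 ++ map suc (inc ds))
  increment t [] = ≗⇒⇝ (λ _ → refl)
  increment t (d ∷ ds) with suc d ≟ k
  ... | no _ = ≗⇒⇝ (λ _ → refl)
  ... | yes d+1≡k = begin
    layered (replicate t 1 ++ suc (suc d) ∷ map suc ds)   ≡⟨ cong (λ n → layered (replicate t 1 ++ suc n ∷ map suc ds)) d+1≡k ⟩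
    layered (replicate t 1 ++ suc k ∷ map suc ds)         ≲⟨ carry t (map suc ds) ⟩
    layered (replicate (suc t) 1 ++ sucHead (map suc ds)) ≲⟨ increment (suc t) ds ⟩
    layered (replicate (suc t) 1 ++ map suc (inc ds))     ≡⟨ cong layered (replicate-suc-++ t 1 _) ⟩
    layered (replicate t 1 ++ 1 ∷ map suc (inc ds))       ∎
    where open ⇝-Reasoning

  initial⇝digits : ∀ N → initial k N ⇝ layered (map suc (digits N))
  initial⇝digits zero = ≗⇒⇝ λ { [] → refl ; (_ ∷ _) → refl }
  initial⇝digits (suc N) = begin
    initial k (suc N)                                     ≈⟨ (λ { [] → refl ; (_ ∷ _) → refl }) ⟩
    addChips (initial k 1) (initial k N)                  ≲⟨ ⇝-addChips (initial k 1) (initial⇝digits N) ⟩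
    addChips (initial k 1) (layered (map suc (digits N))) ≈⟨ root-chip (map suc (digits N)) ⟩
    layered (sucHead (map suc (digits N)))                ≲⟨ increment 0 (digits N) ⟩
    layered (map suc (digits (suc N)))                    ∎
    where
    open ⇝-Reasoning
    root-chip : ∀ ps → addChips (initial k 1) (layered ps) ≗ layered (sucHead ps)
    root-chip [] [] = refl
    root-chip [] (_ ∷ _) = refl
    root-chip (_ ∷ _) [] = refl
    root-chip (_ ∷ _) (_ ∷ _) = refl

mainTheorem2 : (k n N : ℕ) → 2 ≤ k → 1 ≤ n →
    k ^ n ∸ 1 ≤ (k ∸ 1) * N → (k ∸ 1) * N ≤ k ^ (n + 1) ∸ k →
    (a : Fin n → ℕ) → (∀ i → a i < k) →
    (k ∸ 1) * N ≡ (k ^ n ∸ 1) + (k ∸ 1) * digitValue k n a →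
    Σ (Config k) (λ c → Reach k (initial k N) c × Stable k c)
    × (∀ (c : Config k) → Reach k (initial k N) c → Stable k c →
         ∀ (i : Fin n) (v : Vertex k) → length v ≡ toℕ i → c v ≡ suc (a i))
mainTheorem2 1 _ _ (s≤s ()) _ _ _ _ _ _
mainTheorem2 k@(suc (suc K)) n N _ _ _ _ a a<k N-digits with LayeredFiring.initial⇝digits k N
... | d , reach , d≗layered = (d , reach , stable) , layers
  where
  open Firing k
  open Digits k
  digits≡a : digits N ≡ tabulate a
  digits≡a = value-injective (digits-< (s≤s z≤n) N) (tabulate⁺ a<k) (begin
    value (digits N)   ≡⟨ value-digits N ⟩
    N                  ≡⟨ *-cancelˡ-≡ _ _ (suc K) (trans (value-tabulate-scaled (suc K) n a) (sym N-digits)) ⟨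
    value (tabulate a) ∎)
    where open ≡-Reasoning
  stable : Stable k d
  stable = Stable-resp-≗ d≗layered (LayeredFiring.layered-stable k (digits-< (s≤s z≤n) N))
  layers : ∀ c → Reach k (initial k N) c → Stable k c → ∀ i v → length v ≡ toℕ i → c v ≡ suc (a i)
  layers c reach′ stable′ i v depth = begin
    c v                                ≡⟨ stable-unique reach′ stable′ reach stable v ⟩
    d v                                ≡⟨ d≗layered v ⟩
    map suc (digits N) ! length v      ≡⟨ cong₂ (λ ds m → map suc ds ! m) digits≡a depth ⟩
    map suc (tabulate a) ! toℕ i       ≡⟨ cong (_! toℕ i) (map-tabulate a suc) ⟩
    tabulate (λ i → suc (a i)) ! toℕ i ≡⟨ !-tabulate (λ i → suc (a i)) i ⟩
    suc (a i)                          ∎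
    where open ≡-Reasoning
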